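{- Let $D$ be a $\langle 2,2\rangle$ digraph and let $G$ be its competition graph. Then $G$ is an interval graph if and only if $D$ has no subdigraph $D'$ which is a $\langle\bar 2,\bar 2\rangle$ digraph such that (i) $D'$ is irredundant, (ii) $D'$ does not induce a triangle, and (iii) $D'$ has at least one arc.
   Context: All digraphs are finite, without loops and without parallel arcs; all graphs are finite and simple. The competition graph of a digraph $D$ has vertex set $V(D)$ and an edge $uv$ ($u\ne v$) iff $u$ and $v$ have a common out-neighbor in $D$. A $\langle 2,2\rangle$ digraph is a loopless digraph in which every vertex has indegree at most $2$ and outdegree at most $2$ (not necessarily acyclic). A $\langle\bar 2,\bar 2\rangle$ digraph is a loopless digraph in which every vertex has indegree $0$ or $2$ and outdegree $0$ or $2$. A digraph is irredundant if it has no (not necessarily induced) subdigraph isomorphic to $P(2,2)$, the digraph on four distinct vertices $u,v,x,y$ with arcs $(u,x),(u,y),(v,x),(v,y)$. A digraph $D$ induces a triangle if it has a (not necessarily induced) subdigraph isomorphic to one of the following five digraphs: (a) vertices $u_1,u_2,u_3,v_1,v_2,v_3$ with arcs $(u_1,v_1),(u_1,v_3),(u_2,v_1),(u_2,v_2),(u_3,v_2),(u_3,v_3)$; (b) vertices $u_1,u_2,u_3,v_1$ with arcs $(u_1,v_1),(u_2,v_1),(u_3,v_1)$; (c) vertices $u_1,u_2,u_3,v_1,v_3$ with arcs $(u_1,v_1),(u_1,u_2),(u_2,v_1),(u_2,v_3),(u_3,u_2),(u_3,v_3)$; (d) vertices $u_1,u_2,u_3$ with all six arcs $(u_a,u_b)$,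 $a\ne b$; (e) vertices $u_1,u_2,v_1,v_2$ with arcs $(u_1,u_2),(u_2,u_1),(u_1,v_1),(u_2,v_1),(v_2,u_1),(v_2,u_2)$.
   Formalization: The intervals representing an interval graph are closed intervals with rational endpoints. -}

module Defs where

open import Data.Nat using (ℕ; zero; suc; _+_; _≤_)
open import Data.Bool using (Bool; true; false; if_then_else_)
open import Data.Fin using (Fin; #_) renaming (zero to fzero; suc to fsuc)
open import Data.Product using (Σ; ∃; _×_; _,_; proj₁; proj₂)
open import Data.Sum using (_⊎_)
open import Data.List using (List; []; _∷_)
open import Data.List.Relation.Unary.All using (All)
open import Relation.Binary.PropositionalEquality using (_≡_; _≢_)
open import Relation.Nullary using (¬_)
open import Function.Definitions using (Injective)
open import Function.Bundles using (_⇔_)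
import Data.Rational as Q

record Digraph (n : ℕ) : Set where
  field
    arc      : Fin n → Fin n → Bool
    loopless : ∀ v → arc v v ≡ false
open Digraph public

count : ∀ {n} → (Fin n → Bool) → ℕ
count {zero}  f = 0
count {suc n} f = (if f fzero then 1 else 0) + count (λ i → f (fsuc i))

outdeg : ∀ {n} → (Fin n → Fin n → Bool) → Fin n → ℕ
outdeg A v = count (λ w → A v w)

indeg : ∀ {n} → (Fin n → Fin n → Bool) → Fin n → ℕ
indeg A v = count (λ u → A u v)

Is⟨2,2⟩ : ∀ {n} → Digraph n → Set
Is⟨2,2⟩ D = ∀ v → indeg (arc D) v ≤ 2 × outdeg (arc D) v ≤ 2

record Subdigraph {n : ℕ} (D : Digraph n) : Set where
  field
    vset : Fin n → Bool
    sarc : Fin n → Fin n → Bool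
    sub  : ∀ u v → sarc u v ≡ true →
           arc D u v ≡ true × vset u ≡ true × vset v ≡ true
open Subdigraph public

IsBar⟨2,2⟩ : ∀ {n} {D : Digraph n} → Subdigraph D → Set
IsBar⟨2,2⟩ S = ∀ v → vset S v ≡ true →
  (indeg (sarc S) v ≡ 0 ⊎ indeg (sarc S) v ≡ 2) ×
  (outdeg (sarc S) v ≡ 0 ⊎ outdeg (sarc S) v ≡ 2)

record Pattern : Set where
  constructor pat
  field
    size : ℕ
    arcs : List (Fin size × Fin size)

-- S contains a (not necessarily induced) subdigraph isomorphic to P:
-- an injective vertex map into the vertex set of S sending arcs to arcs.
Contains : ∀ {n} {D : Digraph n} → Subdigraph D → Pattern → Set
Contains {n} S (pat k as) =
  Σ (Fin k → Fin n) λ f →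
    Injective _≡_ _≡_ f ×
    (∀ i → vset S (f i) ≡ true) ×
    All (λ e → sarc S (f (proj₁ e)) (f (proj₂ e)) ≡ true) as

-- P(2,2): u=0, v=1, x=2, y=3
P22 : Pattern
P22 = pat 4 ((# 0 , # 2) ∷ (# 0 , # 3) ∷ (# 1 , # 2) ∷ (# 1 , # 3) ∷ [])

Irredundant : ∀ {n} {D : Digraph n} → Subdigraph D → Set
Irredundant S = ¬ Contains S P22

-- (a): u1,u2,u3,v1,v2,v3 = 0..5
TriA : Pattern
TriA = pat 6 ((# 0 , # 3) ∷ (# 0 , # 5) ∷ (# 1 , # 3) ∷ (# 1 , # 4) ∷
              (# 2 , # 4) ∷ (# 2 , # 5) ∷ [])

-- (b): u1,u2,u3,v1 = 0..3
TriB : Pattern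
TriB = pat 4 ((# 0 , # 3) ∷ (# 1 , # 3) ∷ (# 2 , # 3) ∷ [])

-- (c): u1,u2,u3,v1,v3 = 0..4
TriC : Pattern
TriC = pat 5 ((# 0 , # 3) ∷ (# 0 , # 1) ∷ (# 1 , # 3) ∷ (# 1 , # 4) ∷
              (# 2 , # 1) ∷ (# 2 , # 4) ∷ [])

-- (d): u1,u2,u3 = 0..2, all six arcs
TriD : Pattern
TriD = pat 3 ((# 0 , # 1) ∷ (# 1 , # 0) ∷ (# 0 , # 2) ∷ (# 2 , # 0) ∷
              (# 1 , # 2) ∷ (# 2 , # 1) ∷ [])

-- (e): u1,u2,v1,v2 = 0..3
TriE : Pattern
TriE = pat 4 ((# 0 , # 1) ∷ (# 1 , # 0) ∷ (# 0 , # 2) ∷ (# 1 , # 2) ∷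
              (# 3 , # 0) ∷ (# 3 , # 1) ∷ [])

InducesTriangle : ∀ {n} {D : Digraph n} → Subdigraph D → Set
InducesTriangle S =
  Contains S TriA ⊎ Contains S TriB ⊎ Contains S TriC ⊎
  Contains S TriD ⊎ Contains S TriE

HasArc : ∀ {n} {D : Digraph n} → Subdigraph D → Set
HasArc {n} S = Σ (Fin n) λ u → Σ (Fin n) λ v → sarc S u v ≡ true

CompEdge : ∀ {n} → Digraph n → Fin n → Fin n → Set
CompEdge {n} D u v =
  u ≢ v × Σ (Fin n) λ w → arc D u w ≡ true × arc D v w ≡ true

InInterval : Q.ℚ → Q.ℚ × Q.ℚ → Set
InInterval x I = proj₁ I Q.≤ x × x Q.≤ proj₂ I

IsIntervalGraph : ∀ {n} → (Fin n → Fin n → Set) → Set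
IsIntervalGraph {n} E =
  Σ (Fin n → Q.ℚ × Q.ℚ) λ I →
    (∀ v → proj₁ (I v) Q.≤ proj₂ (I v)) ×
    (∀ u v → u ≢ v →
       (E u v ⇔ Σ Q.ℚ λ x → InInterval x (I u) × InInterval x (I v)))

-- The competition graph E of a ⟨2,2⟩ digraph has maximum degree 2.  Such a graph is an
-- interval graph iff it has no obstruction: a nonempty vertex set C each member u of which is
-- the centre of an induced path x – u – y with x, y ∈ C.  An obstruction defeats any interval
-- model at the member of C whose interval ends first.  Without one, some vertex is not such a
-- centre; its at most two neighbours are then adjacent or fewer than two, so it can be removed,
-- the rest modelled by induction, and the vertex re-attached.  Finally, obstructions in E
-- correspond to the forbidden subdigraphs: the arcs of D leaving an obstruction form an
-- irredundant ⟨2̄,2̄⟩ subdigraph inducing no triangle, and conversely the sources of the arcs of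
-- such a subdigraph form an obstruction.
module Submission where

open import Defs
open import Data.Bool using (Bool; true; false; _∧_; if_then_else_)
import Data.Bool as Bool
open import Data.Bool.Properties using (∧-conicalˡ; ∧-conicalʳ; ¬-not; T-≡)
open import Data.Empty using (⊥; ⊥-elim)
open import Data.Fin using (Fin; _≟_; #_) renaming (zero to fzero; suc to fsuc)
import Data.Fin.Properties as Fin
import Data.Fin.Permutation.Components as PC
import Data.Integer as ℤ
import Data.Integer.Properties as ℤ
open import Data.List using (List)
open import Data.List.Relation.Unary.All using (All; []; _∷_)
import Data.Nat as ℕ
open import Data.Nat using (ℕ; zero; suc; _+_; _*_; _∸_; _⊔_; _≤_; _<_; z≤n; s≤s)
open import Data.Nat.Coprimality using (1-coprimeTo)
import Data.Nat.Coprimality as Coprime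
open import Data.Nat.Properties
  using (≡ᵇ⇒≡; ≡⇒≡ᵇ; ≤-refl; ≤-trans; ≤-antisym; ≤-pred; ≤-total; <-irrefl; <⇒≤; n≤1+n; m≤n+m;
         m≤n⇒m≤1+n; m≤m⊔n; m≤n⊔m; +-suc; *-monoˡ-≤; ∸-monoʳ-≤; ∸-monoʳ-<; ∸-cancelʳ-≤)
open import Data.Product using (Σ; _×_; _,_; proj₁; proj₂; swap; map₂)
import Data.Product as Product
import Data.Rational as ℚ
import Data.Rational.Properties as ℚ
open import Data.Sum using (_⊎_; inj₁; inj₂)
import Data.Sum as Sum
open import Data.Vec using (Vec; lookup; []; _∷_)
import Data.Vec.Relation.Unary.All as Vec
open import Data.Vec.Relation.Unary.All using ([]; _∷_)
open import Data.Vec.Relation.Unary.All.Properties using (lookup⁺)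
open import Data.Vec.Relation.Unary.AllPairs using ([]; _∷_)
open import Data.Vec.Relation.Unary.Unique.Propositional using (Unique)
open import Data.Vec.Relation.Unary.Unique.Propositional.Properties using (lookup-injective)
open import Function using (_∘_; case_of_)
open import Function.Bundles using (_⇔_; mk⇔; Equivalence)
open import Function.Consequences using (contraInjective)
open import Function.Definitions using (Injective)
open import Relation.Binary.PropositionalEquality
  using (_≡_; _≢_; refl; sym; trans; cong; cong₂; subst; subst₂; ≢-sym)
open import Relation.Nullary using (¬_; Dec; yes; no; does)
open import Relation.Nullary.Decidable using (_×-dec_; ¬?; False; toWitnessFalse)

-- Counting

true≢false : true ≢ false
true≢false ()

delete : ∀ {n} → Fin n → (Fin n → Bool) → Fin n → Bool
delete i f k = if does (k ≟ i) then false else f k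

delete-true : ∀ {n} (f : Fin n → Bool) {i k} → delete i f k ≡ true → k ≢ i × f k ≡ true
delete-true f {i} {k} fk with k ≟ i
... | no k≢i = k≢i , fk

delete-other : ∀ {n} (f : Fin n → Bool) {i k} → k ≢ i → f k ≡ true → delete i f k ≡ true
delete-other f {i} {k} k≢i fk with k ≟ i
... | yes k≡i = ⊥-elim (k≢i k≡i)
... | no _    = fk

count-delete : ∀ {n} (f : Fin n → Bool) {i} → f i ≡ true → count f ≡ suc (count (delete i f))
count-delete f {fzero}  fi rewrite fi = refl
count-delete f {fsuc i} fi =
  trans (cong ((if f fzero then 1 else 0) +_) (count-delete (f ∘ fsuc) fi)) (+-suc _ _)

count≡0 : ∀ {n} (f : Fin n → Bool) → (∀ i → f i ≡ false) → count f ≡ 0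
count≡0 {zero}  f none = refl
count≡0 {suc n} f none rewrite none fzero = count≡0 (f ∘ fsuc) (none ∘ fsuc)

count-mono : ∀ {n} {f g : Fin n → Bool} → (∀ i → f i ≡ true → g i ≡ true) → count f ≤ count g
count-mono {zero}          f⊆g = z≤n
count-mono {suc n} {f} {g} f⊆g with f fzero in f0 | g fzero in g0
... | false | false = count-mono (f⊆g ∘ fsuc)
... | false | true  = m≤n⇒m≤1+n (count-mono (f⊆g ∘ fsuc))
... | true  | false = ⊥-elim (true≢false (trans (sym (f⊆g fzero f0)) g0))
... | true  | true  = s≤s (count-mono (f⊆g ∘ fsuc))

1≤count⇒true : ∀ {n} (f : Fin n → Bool) → 1 ≤ count f → Σ (Fin n) λ i → f i ≡ true
1≤count⇒true {suc n} f p with f fzero in f0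
... | true  = fzero , f0
... | false with 1≤count⇒true (f ∘ fsuc) p
...   | i , fi = fsuc i , fi

true⇒1≤count : ∀ {n} (f : Fin n → Bool) {i} → f i ≡ true → 1 ≤ count f
true⇒1≤count f fi rewrite count-delete f fi = s≤s z≤n

two-true⇒2≤count : ∀ {n} (f : Fin n → Bool) {i j} → i ≢ j → f i ≡ true → f j ≡ true → 2 ≤ count f
two-true⇒2≤count f i≢j fi fj rewrite count-delete f fi =
  s≤s (true⇒1≤count (delete _ f) (delete-other f (≢-sym i≢j) fj))

another-true : ∀ {n} (f : Fin n → Bool) → 2 ≤ count f → ∀ k → Σ (Fin n) λ j → j ≢ k × f j ≡ true
another-true f 2≤count k with f k in fk
... | true  = map₂ (delete-true f) (1≤count⇒true (delete k f) 1≤rest)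
  where
    1≤rest : 1 ≤ count (delete k f)
    1≤rest = ≤-pred (subst (2 ≤_) (count-delete f fk) 2≤count)
... | false with 1≤count⇒true f (≤-trans (s≤s z≤n) 2≤count)
...   | j , fj = j , (λ { refl → true≢false (trans (sym fj) fk) }) , fj

count≤2⇒one-of : ∀ {n} (f : Fin n → Bool) → count f ≤ 2 → ∀ {i j k} → i ≢ j →
  f i ≡ true → f j ≡ true → f k ≡ true → k ≡ i ⊎ k ≡ j
count≤2⇒one-of f ≤2 {i} {j} {k} i≢j fi fj fk with k ≟ i | k ≟ j
... | yes k≡i | _       = inj₁ k≡i
... | no _    | yes k≡j = inj₂ k≡j
... | no k≢i  | no k≢j  = ⊥-elim (<-irrefl refl (≤-trans 3≤count ≤2))
  where
    3≤count : 3 ≤ count f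
    3≤count rewrite count-delete f fi =
      s≤s (two-true⇒2≤count (delete i f) (≢-sym k≢j)
             (delete-other f (≢-sym i≢j) fj) (delete-other f k≢i fk))

count≤2⇒¬three : ∀ {n} (f : Fin n → Bool) → count f ≤ 2 → ∀ {i j k} → i ≢ j → i ≢ k → j ≢ k →
  f i ≡ true → f j ≡ true → f k ≡ true → ⊥
count≤2⇒¬three f ≤2 i≢j i≢k j≢k fi fj fk with count≤2⇒one-of f ≤2 i≢j fi fj fk
... | inj₁ k≡i = i≢k (sym k≡i)
... | inj₂ k≡j = j≢k (sym k≡j)

-- Graphs of maximum degree two

Graph : ℕ → Set₁
Graph n = Fin n → Fin n → Set

record IsMaxDegree2 {n} (E : Graph n) : Set where
  field
    dec         : ∀ u v → Dec (E u v)
    symmetric   : ∀ {u v} → E u v → E v u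
    irreflexive : ∀ {u v} → E u v → u ≢ v
    deg≤2       : ∀ {u x y z} → E u x → E u y → E u z → x ≢ y → x ≢ z → y ≢ z → ⊥

TwoNeighbours : ∀ {n} → Graph n → Fin n → Set
TwoNeighbours {n} E u = Σ (Fin n) λ x → Σ (Fin n) λ y → x ≢ y × E u x × E u y

Wedge : ∀ {n} → Graph n → (Fin n → Bool) → Fin n → Set
Wedge {n} E C u = Σ (Fin n) λ x → Σ (Fin n) λ y →
  x ≢ y × E u x × E u y × ¬ E x y × C x ≡ true × C y ≡ true

WedgeClosed : ∀ {n} → Graph n → (Fin n → Bool) → Set
WedgeClosed E C = ∀ u → C u ≡ true → Wedge E C u

-- In a graph of maximum degree 2 this is a nonempty union of chordless cycles of length ≥ 4.
Obstruction : ∀ {n} → Graph n → Set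
Obstruction {n} E = Σ (Fin n → Bool) λ C → (Σ (Fin n) λ u → C u ≡ true) × WedgeClosed E C

module _ {n} {E : Graph n} (G : IsMaxDegree2 E) where
  open IsMaxDegree2 G

  wedge? : ∀ C u → Dec (Wedge E C u)
  wedge? C u = Fin.any? λ x → Fin.any? λ y →
    ¬? (x ≟ y) ×-dec dec u x ×-dec dec u y ×-dec ¬? (dec x y) ×-dec
    (C x Bool.≟ true) ×-dec (C y Bool.≟ true)

  wedge-centre-not-in-triangle : ∀ {C p q r} → Wedge E C p → E p q → E p r → E q r → ⊥
  wedge-centre-not-in-triangle {q = q} {r} (x , y , x≢y , px , py , ¬xy , _) pq pr qr
    with q ≟ x | q ≟ y | r ≟ x | r ≟ y
  ... | no q≢x   | no q≢y   | _        | _        = deg≤2 px py pq x≢y (≢-sym q≢x) (≢-sym q≢y)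
  ... | _        | _        | no r≢x   | no r≢y   = deg≤2 px py pr x≢y (≢-sym r≢x) (≢-sym r≢y)
  ... | yes refl | _        | yes refl | _        = irreflexive qr refl
  ... | yes refl | _        | no _     | yes refl = ¬xy qr
  ... | no _     | yes refl | yes refl | _        = ¬xy (symmetric qr)
  ... | no _     | yes refl | no _     | yes refl = irreflexive qr refl

Uncovered : ∀ {n} → (lo hi : Fin n → ℕ) → ℕ → Fin n → Set
Uncovered lo hi p u = ∀ v → v ≢ u → lo v ≤ p → p ≤ hi v → ⊥

FreeEnd : ∀ {n} → Graph n → (lo hi : Fin n → ℕ) → Fin n → Set
FreeEnd E lo hi u = TwoNeighbours E u ⊎ Uncovered lo hi (lo u) u ⊎ Uncovered lo hi (hi u) u

Proper : ∀ {n} → Graph n → (lo hi : Fin n → ℕ) → Fin n → Set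
Proper {n} E lo hi u = (Σ (Fin n) λ v → E u v) ⊎ lo u < hi u

-- free-end and proper are what allows one more vertex to be attached: a vertex of degree < 2
-- has an end lying in no other interval, and an isolated vertex keeps a second free end once
-- something is attached at the first.
record IntervalLabelling {n} (E : Graph n) : Set where
  field
    lo hi    : Fin n → ℕ
    lo≤hi    : ∀ u → lo u ≤ hi u
    meet⇒    : ∀ u v → u ≢ v → E u v → lo u ≤ hi v × lo v ≤ hi u
    meet⇐    : ∀ u v → u ≢ v → lo u ≤ hi v → lo v ≤ hi u → E u v
    free-end : ∀ u → FreeEnd E lo hi u
    proper   : ∀ u → Proper E lo hi u

sup : ∀ {n} → (Fin n → ℕ) → ℕ
sup {zero}  f = 0
sup {suc n} f = f fzero ⊔ sup (f ∘ fsuc)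

≤-sup : ∀ {n} (f : Fin n → ℕ) i → f i ≤ sup f
≤-sup f fzero    = m≤m⊔n _ _
≤-sup f (fsuc i) = ≤-trans (≤-sup (f ∘ fsuc) i) (m≤n⊔m _ _)

module Mirror {n} {E : Graph n} (L : IntervalLabelling E) where
  open IntervalLabelling L

  M : ℕ
  M = sup hi

  lo′ hi′ : Fin n → ℕ
  lo′ u = M ∸ hi u
  hi′ u = M ∸ lo u

  hi≤M : ∀ u → hi u ≤ M
  hi≤M = ≤-sup hi

  lo≤M : ∀ u → lo u ≤ M
  lo≤M u = ≤-trans (lo≤hi u) (hi≤M u)

  reflect : ∀ {p u} → p ≤ M → Uncovered lo hi p u → Uncovered lo′ hi′ (M ∸ p) u
  reflect p≤M F v v≢u q r = F v v≢u (∸-cancelʳ-≤ (lo≤M v) r) (∸-cancelʳ-≤ p≤M q)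

  labelling : IntervalLabelling E
  labelling = record
    { lo       = lo′
    ; hi       = hi′
    ; lo≤hi    = λ u → ∸-monoʳ-≤ M (lo≤hi u)
    ; meet⇒    = λ u v u≢v uv → Product.map (∸-monoʳ-≤ M) (∸-monoʳ-≤ M) (swap (meet⇒ u v u≢v uv))
    ; meet⇐    = λ u v u≢v p q → meet⇐ u v u≢v (∸-cancelʳ-≤ (lo≤M u) q) (∸-cancelʳ-≤ (lo≤M v) p)
    ; free-end = free-end′
    ; proper   = proper′
    }
    where
      free-end′ : ∀ u → FreeEnd E lo′ hi′ u
      free-end′ u with free-end u
      ... | inj₁ two      = inj₁ two
      ... | inj₂ (inj₁ F) = inj₂ (inj₂ (reflect (lo≤M u) F))
      ... | inj₂ (inj₂ F) = inj₂ (inj₁ (reflect (hi≤M u) F))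

      proper′ : ∀ u → Proper E lo′ hi′ u
      proper′ u with proper u
      ... | inj₁ nb = inj₁ nb
      ... | inj₂ lt = inj₂ (∸-monoʳ-< lt (hi≤M u))

module Relabel {n} (σ τ : Fin n → Fin n) (στ : ∀ v → σ (τ v) ≡ v) (τσ : ∀ v → τ (σ v) ≡ v)
               (E : Graph n) where
  Eσ : Graph n
  Eσ u v = E (σ u) (σ v)

  σ-≢ : ∀ {u v} → u ≢ v → σ u ≢ σ v
  σ-≢ {u} {v} u≢v σu≡σv = u≢v (trans (sym (τσ u)) (trans (cong τ σu≡σv) (τσ v)))

  τ-≢ : ∀ {u v} → u ≢ v → τ u ≢ τ v
  τ-≢ {u} {v} u≢v τu≡τv = u≢v (trans (sym (στ u)) (trans (cong σ τu≡τv) (στ v)))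

  toE : ∀ {u v} → Eσ (τ u) (τ v) → E u v
  toE {u} {v} = subst₂ E (στ u) (στ v)

  fromE : ∀ {u v} → E u v → Eσ (τ u) (τ v)
  fromE {u} {v} = subst₂ E (sym (στ u)) (sym (στ v))

  neighbour : ∀ {u x} → Eσ (τ u) x → E u (σ x)
  neighbour {u} {x} = subst (λ w → E w (σ x)) (στ u)

  maxDegree2 : IsMaxDegree2 E → IsMaxDegree2 Eσ
  maxDegree2 G = record
    { dec         = λ u v → dec (σ u) (σ v)
    ; symmetric   = symmetric
    ; irreflexive = λ uv u≡v → irreflexive uv (cong σ u≡v)
    ; deg≤2       = λ ux uy uz x≢y x≢z y≢z → deg≤2 ux uy uz (σ-≢ x≢y) (σ-≢ x≢z) (σ-≢ y≢z)
    }
    where open IsMaxDegree2 G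

  wedge-image : ∀ {u} → Wedge Eσ (λ _ → true) u → Wedge E (λ _ → true) (σ u)
  wedge-image (x , y , x≢y , ux , uy , ¬xy , _) = σ x , σ y , σ-≢ x≢y , ux , uy , ¬xy , refl , refl

  obstruction : Obstruction Eσ → Obstruction E
  obstruction (C , (c , Cc) , closed) = C ∘ τ , (σ c , member Cc) , closed′
    where
      member : ∀ {x} → C x ≡ true → C (τ (σ x)) ≡ true
      member {x} = subst (λ w → C w ≡ true) (sym (τσ x))

      closed′ : WedgeClosed E (C ∘ τ)
      closed′ u Cu with closed (τ u) Cu
      ... | x , y , x≢y , ux , uy , ¬xy , Cx , Cy =
        σ x , σ y , σ-≢ x≢y , neighbour ux , neighbour uy , ¬xy , member Cx , member Cy

  labelling : IntervalLabelling Eσ → IntervalLabelling E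
  labelling L = record
    { lo       = lo ∘ τ
    ; hi       = hi ∘ τ
    ; lo≤hi    = lo≤hi ∘ τ
    ; meet⇒    = λ u v u≢v uv → meet⇒ (τ u) (τ v) (τ-≢ u≢v) (fromE uv)
    ; meet⇐    = λ u v u≢v p q → toE (meet⇐ (τ u) (τ v) (τ-≢ u≢v) p q)
    ; free-end = free-end′
    ; proper   = proper′
    }
    where
      open IntervalLabelling L

      free-end′ : ∀ u → FreeEnd E (lo ∘ τ) (hi ∘ τ) u
      free-end′ u with free-end (τ u)
      ... | inj₁ (x , y , x≢y , ux , uy) = inj₁ (σ x , σ y , σ-≢ x≢y , neighbour ux , neighbour uy)
      ... | inj₂ (inj₁ F) = inj₂ (inj₁ λ v v≢u → F (τ v) (τ-≢ v≢u))
      ... | inj₂ (inj₂ F) = inj₂ (inj₂ λ v v≢u → F (τ v) (τ-≢ v≢u))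

      proper′ : ∀ u → Proper E (lo ∘ τ) (hi ∘ τ) u
      proper′ u with proper (τ u)
      ... | inj₁ (v , uv) = inj₁ (σ v , neighbour uv)
      ... | inj₂ lt       = inj₂ lt

-- The old endpoints are rescaled by x ↦ 3x + 1, which keeps all old overlaps and frees the
-- points 3x and 3x + 2 on either side of each old point for the new interval.
⟪_⟫ : ℕ → ℕ
⟪ x ⟫ = suc (x * 3)

*3≤2+*3⇒≤ : ∀ {x y} → x * 3 ≤ 2 + y * 3 → x ≤ y
*3≤2+*3⇒≤ {zero}          _                     = z≤n
*3≤2+*3⇒≤ {suc x} {zero}  (s≤s (s≤s ()))
*3≤2+*3⇒≤ {suc x} {suc y} (s≤s (s≤s (s≤s p)))   = s≤s (*3≤2+*3⇒≤ p)

⟪⟫-mono : ∀ {x y} → x ≤ y → ⟪ x ⟫ ≤ ⟪ y ⟫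
⟪⟫-mono p = s≤s (*-monoˡ-≤ 3 p)

⟪⟫-mono-< : ∀ {x y} → x < y → ⟪ x ⟫ < ⟪ y ⟫
⟪⟫-mono-< p = ≤-trans (m≤n+m _ 2) (⟪⟫-mono p)

⟪⟫-cancel : ∀ {x y} → ⟪ x ⟫ ≤ ⟪ y ⟫ → x ≤ y
⟪⟫-cancel (s≤s p) = *3≤2+*3⇒≤ (≤-trans p (m≤n+m _ 2))

⟪⟫≤1+⟪⟫⇒≤ : ∀ {x y} → ⟪ x ⟫ ≤ suc ⟪ y ⟫ → x ≤ y
⟪⟫≤1+⟪⟫⇒≤ (s≤s p) = *3≤2+*3⇒≤ (≤-trans p (n≤1+n _))

1+⟪⟫≤⟪⟫⇒< : ∀ {x y} → suc ⟪ x ⟫ ≤ ⟪ y ⟫ → x < y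
1+⟪⟫≤⟪⟫⇒< (s≤s p) = *3≤2+*3⇒≤ (s≤s (s≤s p))

Tail : ∀ {n} → Graph (suc n) → Graph n
Tail E i j = E (fsuc i) (fsuc j)

fsuc-≢ : ∀ {n} {k l : Fin n} → k ≢ l → fsuc k ≢ fsuc l
fsuc-≢ k≢l = k≢l ∘ Fin.suc-injective

tail-maxDegree2 : ∀ {n} {E : Graph (suc n)} → IsMaxDegree2 E → IsMaxDegree2 (Tail E)
tail-maxDegree2 G = record
  { dec         = λ i j → dec (fsuc i) (fsuc j)
  ; symmetric   = symmetric
  ; irreflexive = λ ij i≡j → irreflexive ij (cong fsuc i≡j)
  ; deg≤2       = λ ux uy uz x≢y x≢z y≢z → deg≤2 ux uy uz (fsuc-≢ x≢y) (fsuc-≢ x≢z) (fsuc-≢ y≢z)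
  }
  where open IsMaxDegree2 G

obstruction-from-tail : ∀ {n} {E : Graph (suc n)} → Obstruction (Tail E) → Obstruction E
obstruction-from-tail {E = E} (C , (c , Cc) , closed) = C₀ , (fsuc c , Cc) , closed₀
  where
    C₀ : Fin _ → Bool
    C₀ fzero    = false
    C₀ (fsuc k) = C k

    closed₀ : WedgeClosed E C₀
    closed₀ (fsuc k) Ck with closed k Ck
    ... | x , y , x≢y , kx , ky , ¬xy , Cx , Cy = fsuc x , fsuc y , fsuc-≢ x≢y , kx , ky , ¬xy , Cx , Cy

module Extension {n} {E : Graph (suc n)} (G : IsMaxDegree2 E) (L : IntervalLabelling (Tail E)) where
  open IsMaxDegree2 G
  open IntervalLabelling L

  _∷⟪_⟫ : ℕ → (Fin n → ℕ) → Fin (suc n) → ℕ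
  (α ∷⟪ f ⟫) fzero    = α
  (α ∷⟪ f ⟫) (fsuc k) = ⟪ f k ⟫

  Avoids : ℕ → ℕ → Fin n → Set
  Avoids α β k = ∀ q → q ≤ hi k → Uncovered lo hi q k → α ≤ ⟪ q ⟫ → ⟪ q ⟫ ≤ β → ⊥

  free-end-lift : ∀ {α β} k → Avoids α β k → FreeEnd E (α ∷⟪ lo ⟫) (β ∷⟪ hi ⟫) (fsuc k)
  free-end-lift k avoids with free-end k
  ... | inj₁ (x , y , x≢y , kx , ky) = inj₁ (fsuc x , fsuc y , fsuc-≢ x≢y , kx , ky)
  ... | inj₂ (inj₁ F) = inj₂ (inj₁ λ
    { fzero    _   p q → avoids (lo k) (lo≤hi k) F p q
    ; (fsuc l) l≢k p q → F l (l≢k ∘ cong fsuc) (⟪⟫-cancel p) (⟪⟫-cancel q) })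
  ... | inj₂ (inj₂ F) = inj₂ (inj₂ λ
    { fzero    _   p q → avoids (hi k) ≤-refl F p q
    ; (fsuc l) l≢k p q → F l (l≢k ∘ cong fsuc) (⟪⟫-cancel p) (⟪⟫-cancel q) })

  proper-lift : ∀ {α β} k → Proper E (α ∷⟪ lo ⟫) (β ∷⟪ hi ⟫) (fsuc k)
  proper-lift k with proper k
  ... | inj₁ (v , kv) = inj₁ (fsuc v , kv)
  ... | inj₂ lt       = inj₂ (⟪⟫-mono-< lt)

  extend : ∀ α β → α ≤ β →
    (∀ k → E fzero (fsuc k) → α ≤ ⟪ hi k ⟫ × ⟪ lo k ⟫ ≤ β) →
    (∀ k → α ≤ ⟪ hi k ⟫ → ⟪ lo k ⟫ ≤ β → E fzero (fsuc k)) →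
    (∀ u → FreeEnd E (α ∷⟪ lo ⟫) (β ∷⟪ hi ⟫) u) →
    Proper E (α ∷⟪ lo ⟫) (β ∷⟪ hi ⟫) fzero →
    IntervalLabelling E
  extend α β α≤β edge⇒meet meet⇒edge free proper₀ = record
    { lo       = α ∷⟪ lo ⟫
    ; hi       = β ∷⟪ hi ⟫
    ; lo≤hi    = λ { fzero → α≤β ; (fsuc k) → ⟪⟫-mono (lo≤hi k) }
    ; meet⇒    = meet⇒′
    ; meet⇐    = meet⇐′
    ; free-end = free
    ; proper   = λ { fzero → proper₀ ; (fsuc k) → proper-lift {α} {β} k }
    }
    where
      meet⇒′ : ∀ u v → u ≢ v → E u v → (α ∷⟪ lo ⟫) u ≤ (β ∷⟪ hi ⟫) v × (α ∷⟪ lo ⟫) v ≤ (β ∷⟪ hi ⟫) u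
      meet⇒′ fzero    fzero    0≢0 _  = ⊥-elim (0≢0 refl)
      meet⇒′ fzero    (fsuc k) _   0k = edge⇒meet k 0k
      meet⇒′ (fsuc k) fzero    _   k0 = swap (edge⇒meet k (symmetric k0))
      meet⇒′ (fsuc k) (fsuc l) k≢l kl = Product.map ⟪⟫-mono ⟪⟫-mono (meet⇒ k l (k≢l ∘ cong fsuc) kl)

      meet⇐′ : ∀ u v → u ≢ v → (α ∷⟪ lo ⟫) u ≤ (β ∷⟪ hi ⟫) v → (α ∷⟪ lo ⟫) v ≤ (β ∷⟪ hi ⟫) u → E u v
      meet⇐′ fzero    fzero    0≢0 _ _ = ⊥-elim (0≢0 refl)
      meet⇐′ fzero    (fsuc k) _   p q = meet⇒edge k p q
      meet⇐′ (fsuc k) fzero    _   p q = symmetric (meet⇒edge k q p)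
      meet⇐′ (fsuc k) (fsuc l) k≢l p q = meet⇐ k l (k≢l ∘ cong fsuc) (⟪⟫-cancel p) (⟪⟫-cancel q)

  -- The new interval is placed beyond all the others.
  attach-isolated : (∀ v → ¬ E fzero v) → IntervalLabelling E
  attach-isolated isolated =
    extend α (suc α) (n≤1+n α) (λ k 0k → ⊥-elim (isolated (fsuc k) 0k))
      (λ k p _ → ⊥-elim (beyond k ≤-refl p)) free (inj₂ ≤-refl)
    where
      α = suc ⟪ sup hi ⟫

      beyond : ∀ {q} k → q ≤ hi k → α ≤ ⟪ q ⟫ → ⊥
      beyond k q≤hi p = <-irrefl refl (≤-trans (1+⟪⟫≤⟪⟫⇒< p) (≤-trans q≤hi (≤-sup hi k)))

      free : ∀ u → FreeEnd E (α ∷⟪ lo ⟫) (suc α ∷⟪ hi ⟫) u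
      free fzero    = inj₂ (inj₁ λ { fzero 0≢0 _ _ → 0≢0 refl ; (fsuc l) _ _ q → beyond l ≤-refl q })
      free (fsuc k) = free-end-lift k λ q q≤hi _ p _ → beyond k q≤hi p

  -- The new interval [3h+1, 3h+2] hangs off the uncovered right end h of its only neighbour i.
  attach-pendant : ∀ i → E fzero (fsuc i) → (∀ w → E fzero w → w ≡ fsuc i) →
                   Uncovered lo hi (hi i) i → IntervalLabelling E
  attach-pendant i 0i only-i F = extend α β (n≤1+n α) edge⇒meet meet⇒edge free (inj₁ (fsuc i , 0i))
    where
      α = ⟪ hi i ⟫
      β = suc α

      edge⇒meet : ∀ k → E fzero (fsuc k) → α ≤ ⟪ hi k ⟫ × ⟪ lo k ⟫ ≤ β
      edge⇒meet k 0k with only-i (fsuc k) 0k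
      ... | refl = ≤-refl , ≤-trans (⟪⟫-mono (lo≤hi i)) (n≤1+n α)

      meet⇒edge : ∀ k → α ≤ ⟪ hi k ⟫ → ⟪ lo k ⟫ ≤ β → E fzero (fsuc k)
      meet⇒edge k p q with k ≟ i
      ... | yes refl = 0i
      ... | no k≢i   = ⊥-elim (F k k≢i (⟪⟫≤1+⟪⟫⇒≤ q) (⟪⟫-cancel p))

      β-uncovered : ∀ l → ⟪ lo l ⟫ ≤ β → β ≤ ⟪ hi l ⟫ → ⊥
      β-uncovered l p q with l ≟ i
      ... | yes refl = <-irrefl refl (1+⟪⟫≤⟪⟫⇒< {hi i} q)
      ... | no l≢i   = F l l≢i (⟪⟫≤1+⟪⟫⇒≤ p) (<⇒≤ (1+⟪⟫≤⟪⟫⇒< {hi i} q))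

      -- Once i has no other neighbour its interval is proper, so its left end stays free.
      lo-i-uncovered : ¬ (Σ (Fin n) λ w → Tail E i w) →
                       Uncovered (α ∷⟪ lo ⟫) (β ∷⟪ hi ⟫) ⟪ lo i ⟫ (fsuc i)
      lo-i-uncovered lonely fzero _ p _ with proper i
      ... | inj₁ nb    = lonely nb
      ... | inj₂ lo<hi = <-irrefl refl (≤-trans lo<hi (⟪⟫-cancel p))
      lo-i-uncovered lonely (fsuc l) l≢i p q =
        lonely (l , symmetric (meet⇐ l i (l≢i ∘ cong fsuc)
                                  (≤-trans (⟪⟫-cancel p) (lo≤hi i)) (⟪⟫-cancel q)))

      free : ∀ u → FreeEnd E (α ∷⟪ lo ⟫) (β ∷⟪ hi ⟫) u
      free fzero = inj₂ (inj₂ λ { fzero 0≢0 _ _ → 0≢0 refl ; (fsuc l) _ → β-uncovered l })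
      free (fsuc k) with k ≟ i
      ... | no k≢i = free-end-lift k λ q _ Fk p r →
        Fk i (≢-sym k≢i) (≤-trans (lo≤hi i) (⟪⟫-cancel p)) (⟪⟫≤1+⟪⟫⇒≤ r)
      ... | yes refl with Fin.any? (λ w → dec (fsuc i) (fsuc w))
      ...   | yes (w , iw) = inj₁ (fsuc w , fzero , (λ ()) , iw , symmetric 0i)
      ...   | no lonely    = inj₂ (inj₁ (lo-i-uncovered lonely))

  common-point : ∀ {i j} → i ≢ j → Tail E i j → Σ ℕ λ p → lo i ≤ p × p ≤ hi i × lo j ≤ p × p ≤ hi j
  common-point {i} {j} i≢j ij with meet⇒ i j i≢j ij | ≤-total (lo i) (lo j)
  ... | _ , j≤i | inj₁ i≤j = lo j , i≤j , j≤i , ≤-refl , lo≤hi j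
  ... | i≤j , _ | inj₂ j≤i = lo i , ≤-refl , lo≤hi i , j≤i , i≤j

  -- The new interval is a single point shared by the intervals of its two neighbours.
  attach-to-edge : ∀ {i j} → i ≢ j → E fzero (fsuc i) → E fzero (fsuc j) → Tail E i j →
                   IntervalLabelling E
  attach-to-edge {i} {j} i≢j 0i 0j ij with common-point i≢j ij
  ... | p , lo-i≤p , p≤hi-i , lo-j≤p , p≤hi-j =
    extend ⟪ p ⟫ ⟪ p ⟫ ≤-refl edge⇒meet meet⇒edge free (inj₁ (fsuc i , 0i))
    where
      edge⇒meet : ∀ k → E fzero (fsuc k) → ⟪ p ⟫ ≤ ⟪ hi k ⟫ × ⟪ lo k ⟫ ≤ ⟪ p ⟫
      edge⇒meet k 0k with k ≟ i | k ≟ j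
      ... | yes refl | _        = ⟪⟫-mono p≤hi-i , ⟪⟫-mono lo-i≤p
      ... | no _     | yes refl = ⟪⟫-mono p≤hi-j , ⟪⟫-mono lo-j≤p
      ... | no k≢i   | no k≢j   =
        ⊥-elim (deg≤2 0i 0j 0k (fsuc-≢ i≢j) (fsuc-≢ (≢-sym k≢i)) (fsuc-≢ (≢-sym k≢j)))

      meet⇒edge : ∀ k → ⟪ p ⟫ ≤ ⟪ hi k ⟫ → ⟪ lo k ⟫ ≤ ⟪ p ⟫ → E fzero (fsuc k)
      meet⇒edge k p≤hi lo≤p with k ≟ i | k ≟ j
      ... | yes refl | _        = 0i
      ... | no _     | yes refl = 0j
      ... | no k≢i   | no k≢j   = ⊥-elim (deg≤2 ik ij (symmetric 0i) (fsuc-≢ k≢j) (λ ()) (λ ()))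
        where
          ik : Tail E i k
          ik = meet⇐ i k (≢-sym k≢i) (≤-trans lo-i≤p (⟪⟫-cancel p≤hi)) (≤-trans (⟪⟫-cancel lo≤p) p≤hi-i)

      free : ∀ u → FreeEnd E (⟪ p ⟫ ∷⟪ lo ⟫) (⟪ p ⟫ ∷⟪ hi ⟫) u
      free fzero = inj₁ (fsuc i , fsuc j , fsuc-≢ i≢j , 0i , 0j)
      free (fsuc k) with k ≟ i | k ≟ j
      ... | yes refl | _        = inj₁ (fzero , fsuc j , (λ ()) , symmetric 0i , ij)
      ... | no _     | yes refl = inj₁ (fzero , fsuc i , (λ ()) , symmetric 0j , symmetric ij)
      ... | no k≢i   | no _     = free-end-lift k λ q _ Fk p≤q q≤p →
        Fk i (≢-sym k≢i) (≤-trans lo-i≤p (⟪⟫-cancel p≤q)) (≤-trans (⟪⟫-cancel q≤p) p≤hi-i)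

module _ {n} {E : Graph (suc n)} (G : IsMaxDegree2 E) (L : IntervalLabelling (Tail E)) where
  open IsMaxDegree2 G
  open IntervalLabelling L
  open Extension G L

  -- A pendant vertex i has an uncovered end; at a left end we work in the mirror image.
  attach-pendant′ : ∀ i → E fzero (fsuc i) → (∀ w → E fzero w → w ≡ fsuc i) → IntervalLabelling E
  attach-pendant′ i 0i only-i with free-end i
  ... | inj₁ (x , y , x≢y , ix , iy) = ⊥-elim (deg≤2 ix iy (symmetric 0i) (fsuc-≢ x≢y) (λ ()) (λ ()))
  ... | inj₂ (inj₁ F) =
    Extension.attach-pendant G (Mirror.labelling L) i 0i only-i (Mirror.reflect L (Mirror.lo≤M L i) F)
  ... | inj₂ (inj₂ F) = attach-pendant i 0i only-i F

  extension : ¬ Wedge E (λ _ → true) fzero → IntervalLabelling E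
  extension no-wedge with Fin.any? (dec fzero)
  ... | no isolated      = attach-isolated λ v 0v → isolated (v , 0v)
  ... | yes (fzero , loop) = ⊥-elim (irreflexive loop refl)
  ... | yes (fsuc i , 0i) with Fin.any? (λ w → ¬? (w ≟ fsuc i) ×-dec dec fzero w)
  ...   | no none-but-i = attach-pendant′ i 0i only-i
    where
      only-i : ∀ w → E fzero w → w ≡ fsuc i
      only-i w 0w with w ≟ fsuc i
      ... | yes w≡i = w≡i
      ... | no w≢i  = ⊥-elim (none-but-i (w , w≢i , 0w))
  ...   | yes (fzero , _ , loop)        = ⊥-elim (irreflexive loop refl)
  ...   | yes (fsuc j , j≢i , 0j) with dec (fsuc i) (fsuc j)
  ...     | yes ij = attach-to-edge (≢-sym (j≢i ∘ cong fsuc)) 0i 0j ij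
  ...     | no ¬ij = ⊥-elim (no-wedge (fsuc i , fsuc j , ≢-sym j≢i , 0i , 0j , ¬ij , refl , refl))

obstruction-or-labelling : ∀ {n} {E : Graph n} → IsMaxDegree2 E → Obstruction E ⊎ IntervalLabelling E
obstruction-or-labelling {zero} G = inj₂ record
  { lo = λ () ; hi = λ () ; lo≤hi = λ () ; meet⇒ = λ () ; meet⇐ = λ ()
  ; free-end = λ () ; proper = λ () }
obstruction-or-labelling {suc n} {E} G with Fin.all? (wedge? G (λ _ → true))
... | yes everywhere = inj₁ ((λ _ → true) , (fzero , refl) , λ u _ → everywhere u)
... | no ¬everywhere with Fin.¬∀⟶∃¬ (suc n) _ (wedge? G (λ _ → true)) ¬everywhere
...   | x , no-wedge-at-x =
  Sum.map (obstruction ∘ obstruction-from-tail)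
          (λ L → labelling (extension G₀ L (no-wedge-at-x ∘ wedge-image {fzero})))
          (obstruction-or-labelling (tail-maxDegree2 G₀))
  where
    open Relabel (PC.transpose fzero x) (PC.transpose x fzero)
                 (λ _ → PC.transpose-inverse fzero x) (λ _ → PC.transpose-inverse x fzero) E
    G₀ : IsMaxDegree2 Eσ
    G₀ = maxDegree2 G

ℕ→ℚ : ℕ → ℚ.ℚ
ℕ→ℚ k = ℚ.mkℚ (ℤ.+ k) 0 (Coprime.sym (1-coprimeTo k))

ℕ→ℚ-mono : ∀ {a b} → a ≤ b → ℕ→ℚ a ℚ.≤ ℕ→ℚ b
ℕ→ℚ-mono {a} {b} p =
  ℚ.*≤* (subst₂ ℤ._≤_ (sym (ℤ.*-identityʳ (ℤ.+ a))) (sym (ℤ.*-identityʳ (ℤ.+ b))) (ℤ.+≤+ p))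

ℕ→ℚ-cancel : ∀ {a b} → ℕ→ℚ a ℚ.≤ ℕ→ℚ b → a ≤ b
ℕ→ℚ-cancel {a} {b} (ℚ.*≤* p) with subst₂ ℤ._≤_ (ℤ.*-identityʳ (ℤ.+ a)) (ℤ.*-identityʳ (ℤ.+ b)) p
... | ℤ.+≤+ q = q

labelling⇒interval : ∀ {n} {E : Graph n} → IntervalLabelling E → IsIntervalGraph E
labelling⇒interval {E = E} L =
  (λ v → ℕ→ℚ (lo v) , ℕ→ℚ (hi v)) , (λ v → ℕ→ℚ-mono (lo≤hi v)) ,
  λ u v u≢v → mk⇔ (to u v u≢v) (from u v u≢v)
  where
    open IntervalLabelling L
    Meet : Fin _ → Fin _ → Set
    Meet u v = Σ ℚ.ℚ λ x →
      InInterval x (ℕ→ℚ (lo u) , ℕ→ℚ (hi u)) × InInterval x (ℕ→ℚ (lo v) , ℕ→ℚ (hi v))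

    to : ∀ u v → u ≢ v → E u v → Meet u v
    to u v u≢v uv with meet⇒ u v u≢v uv | ≤-total (lo u) (lo v)
    ... | _ , v≤u | inj₁ u≤v =
      ℕ→ℚ (lo v) , (ℕ→ℚ-mono u≤v , ℕ→ℚ-mono v≤u) , (ℚ.≤-refl , ℕ→ℚ-mono (lo≤hi v))
    ... | u≤v , _ | inj₂ v≤u =
      ℕ→ℚ (lo u) , (ℚ.≤-refl , ℕ→ℚ-mono (lo≤hi u)) , (ℕ→ℚ-mono v≤u , ℕ→ℚ-mono u≤v)

    from : ∀ u v → u ≢ v → Meet u v → E u v
    from u v u≢v (x , (lu≤x , x≤hu) , (lv≤x , x≤hv)) =
      meet⇐ u v u≢v (ℕ→ℚ-cancel (ℚ.≤-trans lu≤x x≤hv)) (ℕ→ℚ-cancel (ℚ.≤-trans lv≤x x≤hu))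

minimise : ∀ {n} (C : Fin n → Bool) (f : Fin n → ℚ.ℚ) →
  (∀ v → C v ≡ false) ⊎ Σ (Fin n) λ m → C m ≡ true × (∀ v → C v ≡ true → f m ℚ.≤ f v)
minimise {zero} C f = inj₁ λ ()
minimise {suc n} C f with minimise (C ∘ fsuc) (f ∘ fsuc) | C fzero in C0
... | inj₁ none | false = inj₁ λ { fzero → C0 ; (fsuc k) → none k }
... | inj₁ none | true  = inj₂ (fzero , C0 , λ
  { fzero    _  → ℚ.≤-refl
  ; (fsuc k) Ck → ⊥-elim (true≢false (trans (sym Ck) (none k))) })
... | inj₂ (m , Cm , least) | false = inj₂ (fsuc m , Cm , λ
  { fzero    C0′ → ⊥-elim (true≢false (trans (sym C0′) C0))
  ; (fsuc k)     → least k })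
... | inj₂ (m , Cm , least) | true with ℚ.≤-total (f fzero) (f (fsuc m))
...   | inj₁ le = inj₂ (fzero , C0 , λ { fzero _ → ℚ.≤-refl ; (fsuc k) Ck → ℚ.≤-trans le (least k Ck) })
...   | inj₂ le = inj₂ (fsuc m , Cm , λ { fzero _ → le ; (fsuc k) → least k })

-- The right end of the member of C whose interval ends first lies in the intervals of both
-- ends of its wedge, which would therefore be adjacent.
obstruction⇒¬interval : ∀ {n} {E : Graph n} → (∀ {u v} → E u v → u ≢ v) →
                        Obstruction E → ¬ IsIntervalGraph E
obstruction⇒¬interval {E = E} irreflexive (C , (c , Cc) , closed) (I , _ , model)
  with minimise C (proj₂ ∘ I)
... | inj₁ none = true≢false (trans (sym Cc) (none c))
... | inj₂ (u , Cu , least) with closed u Cu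
... | x , y , x≢y , ux , uy , ¬xy , Cx , Cy =
  ¬xy (Equivalence.from (model x y x≢y) (proj₂ (I u) , contains x ux Cx , contains y uy Cy))
  where
    contains : ∀ w → E u w → C w ≡ true → InInterval (proj₂ (I u)) (I w)
    contains w uw Cw with Equivalence.to (model u w (irreflexive uw)) uw
    ... | _ , (_ , t≤hu) , (lw≤t , _) = ℚ.≤-trans lw≤t t≤hu , least w Cw

maxDegree2-interval⇔¬obstruction : ∀ {n} {E : Graph n} → IsMaxDegree2 E →
                                   IsIntervalGraph E ⇔ (¬ Obstruction E)
maxDegree2-interval⇔¬obstruction G = mk⇔
  (λ interval obstruction → obstruction⇒¬interval (IsMaxDegree2.irreflexive G) obstruction interval)
  (λ ¬obstruction → Sum.[ ⊥-elim ∘ ¬obstruction , labelling⇒interval ]′ (obstruction-or-labelling G))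

-- Competition graphs of ⟨2,2⟩ digraphs

apart : ∀ {k n} {f : Fin k → Fin n} → Injective _≡_ _≡_ f → ∀ {i j} {i≢j : False (i ≟ j)} → f i ≢ f j
apart inj {i} {j} {i≢j} = contraInjective _≡_ inj {i} {j} (toWitnessFalse {a? = i ≟ j} i≢j)

embedding : ∀ {n} {D : Digraph n} {S : Subdigraph D} {k} {as : List (Fin k × Fin k)}
  (vs : Vec (Fin n) k) → Unique vs → Vec.All (λ v → vset S v ≡ true) vs →
  All (λ e → sarc S (lookup vs (proj₁ e)) (lookup vs (proj₂ e)) ≡ true) as →
  Contains S (pat k as)
embedding vs distinct members arcs = lookup vs , lookup-injective distinct _ _ , lookup⁺ members , arcs

ForbiddenSubdigraph : ∀ {n} → Digraph n → Set
ForbiddenSubdigraph D =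
  Σ (Subdigraph D) λ S → IsBar⟨2,2⟩ S × Irredundant S × ¬ InducesTriangle S × HasArc S

module ⟨2,2⟩Digraph {n} (D : Digraph n) (h : Is⟨2,2⟩ D) where
  A : Fin n → Fin n → Bool
  A = arc D

  E : Graph n
  E = CompEdge D

  arc⇒≢ : ∀ {u w} → A u w ≡ true → u ≢ w
  arc⇒≢ {u} uw refl = true≢false (trans (sym uw) (loopless D u))

  in-neighbour : ∀ {w u x z} → u ≢ x → A u w ≡ true → A x w ≡ true → A z w ≡ true → z ≡ u ⊎ z ≡ x
  in-neighbour {w} = count≤2⇒one-of (λ v → A v w) (proj₁ (h w))

  out-neighbour : ∀ {u w₁ w₂ z} → w₁ ≢ w₂ → A u w₁ ≡ true → A u w₂ ≡ true → A u z ≡ true → z ≡ w₁ ⊎ z ≡ w₂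
  out-neighbour {u} = count≤2⇒one-of (A u) (proj₂ (h u))

  ¬three-in : ∀ {w u x y} → u ≢ x → u ≢ y → x ≢ y → A u w ≡ true → A x w ≡ true → A y w ≡ true → ⊥
  ¬three-in {w} = count≤2⇒¬three (λ v → A v w) (proj₁ (h w))

  competition-maxDegree2 : IsMaxDegree2 E
  competition-maxDegree2 = record
    { dec         = λ u v → ¬? (u ≟ v) ×-dec Fin.any? (λ w → A u w Bool.≟ true ×-dec A v w Bool.≟ true)
    ; symmetric   = λ (u≢v , w , uw , vw) → ≢-sym u≢v , w , vw , uw
    ; irreflexive = proj₁
    ; deg≤2       = deg≤2
    }
    where
      deg≤2 : ∀ {u x y z} → E u x → E u y → E u z → x ≢ y → x ≢ z → y ≢ z → ⊥
      deg≤2 (u≢x , wx , uwx , xwx) (u≢y , wy , uwy , ywy) (u≢z , wz , uwz , zwz) x≢y x≢z y≢z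
        with wx ≟ wy | wx ≟ wz | wy ≟ wz
      ... | yes refl | _        | _        = ¬three-in u≢x u≢y x≢y uwx xwx ywy
      ... | no _     | yes refl | _        = ¬three-in u≢x u≢z x≢z uwx xwx zwz
      ... | no _     | no _     | yes refl = ¬three-in u≢y u≢z y≢z uwy ywy zwz
      ... | no wx≢wy | no wx≢wz | no wy≢wz =
        count≤2⇒¬three (A _) (proj₂ (h _)) wx≢wy wx≢wz wy≢wz uwx uwy uwz

  module ArcsFrom (C : Fin n → Bool) (closed : WedgeClosed E C) where
    S : Subdigraph D
    S = record
      { vset = λ _ → true
      ; sarc = λ u w → C u ∧ A u w
      ; sub  = λ u w uw → ∧-conicalʳ _ _ uw , refl , refl
      }

    record WedgeArcs (u : Fin n) : Set where
      field
        x y wx wy : Fin n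
        u≢x   : u ≢ x
        u≢y   : u ≢ y
        x≢y   : x ≢ y
        wx≢wy : wx ≢ wy
        u→wx  : A u wx ≡ true
        x→wx  : A x wx ≡ true
        u→wy  : A u wy ≡ true
        y→wy  : A y wy ≡ true
        Cx    : C x ≡ true
        Cy    : C y ≡ true

    wedge-arcs : ∀ {u} → C u ≡ true → WedgeArcs u
    wedge-arcs Cu with closed _ Cu
    ... | x , y , x≢y , (u≢x , wx , u→wx , x→wx) , (u≢y , wy , u→wy , y→wy) , _ , Cx , Cy = record
      { x = x ; y = y ; wx = wx ; wy = wy ; u≢x = u≢x ; u≢y = u≢y ; x≢y = x≢y
      ; wx≢wy = λ { refl → ¬three-in u≢x u≢y x≢y u→wx x→wx y→wy }
      ; u→wx = u→wx ; x→wx = x→wx ; u→wy = u→wy ; y→wy = y→wy ; Cx = Cx ; Cy = Cy }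

    outdeg-0-or-2 : ∀ u → outdeg (sarc S) u ≡ 0 ⊎ outdeg (sarc S) u ≡ 2
    outdeg-0-or-2 u with C u in Cu
    ... | false = inj₁ (count≡0 (λ w → false ∧ A u w) λ _ → refl)
    ... | true  = inj₂ (≤-antisym (proj₂ (h u)) (two-true⇒2≤count (A u) wx≢wy u→wx u→wy))
      where open WedgeArcs (wedge-arcs Cu)

    -- A member u of C entering w brings along the other end of its wedge through w.
    indeg-0-or-2 : ∀ w → indeg (sarc S) w ≡ 0 ⊎ indeg (sarc S) w ≡ 2
    indeg-0-or-2 w with Fin.any? (λ u → (C u ∧ A u w) Bool.≟ true)
    ... | no none = inj₁ (count≡0 _ λ u → ¬-not (λ uw → none (u , uw)))
    ... | yes (u , uw) = inj₂ (≤-antisym (≤-trans indeg≤indegᴰ (proj₁ (h w))) 2≤indeg)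
      where
        open WedgeArcs (wedge-arcs (∧-conicalˡ _ _ uw))

        indeg≤indegᴰ : indeg (sarc S) w ≤ indeg A w
        indeg≤indegᴰ = count-mono {f = λ v → C v ∧ A v w} λ _ → ∧-conicalʳ _ _

        2≤indeg : 2 ≤ indeg (sarc S) w
        2≤indeg with out-neighbour wx≢wy u→wx u→wy (∧-conicalʳ _ _ uw)
        ... | inj₁ w≡wx = two-true⇒2≤count _ u≢x uw (cong₂ _∧_ Cx (subst (λ t → A x t ≡ true) (sym w≡wx) x→wx))
        ... | inj₂ w≡wy = two-true⇒2≤count _ u≢y uw (cong₂ _∧_ Cy (subst (λ t → A y t ≡ true) (sym w≡wy) y→wy))

    bar : IsBar⟨2,2⟩ S
    bar v _ = indeg-0-or-2 v , outdeg-0-or-2 v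

    -- Both ends of the wedge at a source u of P(2,2) share an out-neighbour with u, so both
    -- are the other source.
    irredundant : Irredundant S
    irredundant (f , inj , _ , (a02 ∷ a03 ∷ a12 ∷ a13 ∷ [])) =
      x≢y (trans (is-f1 u≢x u→wx x→wx) (sym (is-f1 u≢y u→wy y→wy)))
      where
        open WedgeArcs (wedge-arcs (∧-conicalˡ _ _ a02))
        A′ : ∀ {p q} → C p ∧ A p q ≡ true → A p q ≡ true
        A′ = ∧-conicalʳ _ _
        other : ∀ {u z v} → z ≡ u ⊎ z ≡ v → u ≢ z → z ≡ v
        other (inj₁ refl) u≢z = ⊥-elim (u≢z refl)
        other (inj₂ z≡v)  _   = z≡v
        is-f1 : ∀ {z w} → f (# 0) ≢ z → A (f (# 0)) w ≡ true → A z w ≡ true → z ≡ f (# 1)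
        is-f1 f0≢z f0w zw with out-neighbour (apart inj {# 2} {# 3}) (A′ a02) (A′ a03) f0w
        ... | inj₁ refl = other (in-neighbour (apart inj {# 0} {# 1}) (A′ a02) (A′ a12) zw) f0≢z
        ... | inj₂ refl = other (in-neighbour (apart inj {# 0} {# 1}) (A′ a03) (A′ a13) zw) f0≢z

    competing : ∀ {p q w} → p ≢ q → C p ∧ A p w ≡ true → C q ∧ A q w ≡ true → E p q
    competing p≢q pw qw = p≢q , _ , ∧-conicalʳ _ _ pw , ∧-conicalʳ _ _ qw

    not-in-triangle : ∀ {p q r w} → C p ∧ A p w ≡ true → E p q → E p r → E q r → ⊥
    not-in-triangle pw =
      wedge-centre-not-in-triangle competition-maxDegree2 (closed _ (∧-conicalˡ _ _ pw))

    -- Each triangle pattern consists of three pairwise competing members of C.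
    ¬triangle : ¬ InducesTriangle S
    ¬triangle (inj₁ (f , inj , _ , (a03 ∷ a05 ∷ a13 ∷ a14 ∷ a24 ∷ a25 ∷ []))) =
      not-in-triangle a03 (competing (apart inj) a03 a13) (competing (apart inj) a05 a25)
        (competing (apart inj) a14 a24)
    ¬triangle (inj₂ (inj₁ (f , inj , _ , (a03 ∷ a13 ∷ a23 ∷ [])))) =
      not-in-triangle a03 (competing (apart inj) a03 a13) (competing (apart inj) a03 a23)
        (competing (apart inj) a13 a23)
    ¬triangle (inj₂ (inj₂ (inj₁ (f , inj , _ , (a03 ∷ a01 ∷ a13 ∷ a14 ∷ a21 ∷ a24 ∷ []))))) =
      not-in-triangle a03 (competing (apart inj) a03 a13) (competing (apart inj) a01 a21)
        (competing (apart inj) a14 a24)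
    ¬triangle (inj₂ (inj₂ (inj₂ (inj₁ (f , inj , _ , (a01 ∷ a10 ∷ a02 ∷ a20 ∷ a12 ∷ a21 ∷ [])))))) =
      not-in-triangle a01 (competing (apart inj) a02 a12) (competing (apart inj) a01 a21)
        (competing (apart inj) a10 a20)
    ¬triangle (inj₂ (inj₂ (inj₂ (inj₂ (f , inj , _ , (a01 ∷ a10 ∷ a02 ∷ a12 ∷ a30 ∷ a31 ∷ [])))))) =
      not-in-triangle a01 (competing (apart inj) a02 a12) (competing (apart inj) a01 a31)
        (competing (apart inj) a10 a30)

    forbidden : Σ (Fin n) (λ c → C c ≡ true) → ForbiddenSubdigraph D
    forbidden (c , Cc) = S , bar , irredundant , ¬triangle , (c , wx , cong₂ _∧_ Cc u→wx)
      where open WedgeArcs (wedge-arcs Cc)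

  obstruction⇒forbidden : Obstruction E → ForbiddenSubdigraph D
  obstruction⇒forbidden (C , nonempty , closed) = ArcsFrom.forbidden C closed nonempty

  module SourcesOf (S : Subdigraph D) (bar : IsBar⟨2,2⟩ S) (irr : Irredundant S)
                   (¬tri : ¬ InducesTriangle S) where
    B : Fin n → Fin n → Bool
    B = sarc S

    in-D : ∀ {u w} → B u w ≡ true → A u w ≡ true
    in-D {u} {w} uw = proj₁ (sub S u w uw)

    source : ∀ {u w} → B u w ≡ true → vset S u ≡ true
    source {u} {w} uw = proj₁ (proj₂ (sub S u w uw))

    target : ∀ {u w} → B u w ≡ true → vset S w ≡ true
    target {u} {w} uw = proj₂ (proj₂ (sub S u w uw))

    B⇒≢ : ∀ {u w} → B u w ≡ true → u ≢ w
    B⇒≢ uw = arc⇒≢ (in-D uw)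

    outdeg≡2 : ∀ {u w} → B u w ≡ true → outdeg B u ≡ 2
    outdeg≡2 {u} uw with proj₂ (bar u (source uw))
    ... | inj₂ two  = two
    ... | inj₁ ≡0 = case subst (1 ≤_) ≡0 (true⇒1≤count (B u) uw) of λ ()

    indeg≡2 : ∀ {u w} → B u w ≡ true → indeg B w ≡ 2
    indeg≡2 {w = w} uw with proj₁ (bar w (target uw))
    ... | inj₂ two  = two
    ... | inj₁ ≡0 = case subst (1 ≤_) ≡0 (true⇒1≤count (λ v → B v w) uw) of λ ()

    another-out : ∀ {u w} → B u w ≡ true → Σ (Fin n) λ w′ → w′ ≢ w × B u w′ ≡ true
    another-out {u} {w} uw = another-true (B u) (subst (2 ≤_) (sym (outdeg≡2 uw)) ≤-refl) w

    another-in : ∀ {u w} → B u w ≡ true → Σ (Fin n) λ u′ → u′ ≢ u × B u′ w ≡ true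
    another-in {u} {w} uw = another-true (λ v → B v w) (subst (2 ≤_) (sym (indeg≡2 uw)) ≤-refl) u

    -- the sources of arcs of S, as out-degrees in S are 0 or 2
    C : Fin n → Bool
    C u = outdeg B u ℕ.≡ᵇ 2

    source∈C : ∀ {u w} → B u w ≡ true → C u ≡ true
    source∈C {u} uw = Equivalence.to T-≡ (≡⇒≡ᵇ _ 2 (outdeg≡2 uw))

    C⇒arc : ∀ {u} → C u ≡ true → Σ (Fin n) λ w → B u w ≡ true
    C⇒arc {u} Cu = 1≤count⇒true (B u) (subst (1 ≤_) (sym (≡ᵇ⇒≡ _ 2 (Equivalence.from T-≡ Cu))) (s≤s z≤n))

    ¬patternA : ¬ Contains S TriA
    ¬patternA = ¬tri ∘ inj₁

    ¬patternC : ¬ Contains S TriC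
    ¬patternC = ¬tri ∘ inj₂ ∘ inj₂ ∘ inj₁

    ¬patternD : ¬ Contains S TriD
    ¬patternD = ¬tri ∘ inj₂ ∘ inj₂ ∘ inj₂ ∘ inj₁

    ¬patternE : ¬ Contains S TriE
    ¬patternE = ¬tri ∘ inj₂ ∘ inj₂ ∘ inj₂ ∘ inj₂

    -- Three sources pairwise sharing distinct targets form one of the triangle patterns; which
    -- one depends on how the targets coincide with the sources.
    ¬shared-targets : ∀ {u x y w₁ w₂ w₃} → u ≢ x → u ≢ y → x ≢ y → w₁ ≢ w₂ → w₁ ≢ w₃ → w₂ ≢ w₃ →
      B u w₁ ≡ true → B x w₁ ≡ true → B u w₂ ≡ true → B y w₂ ≡ true → B x w₃ ≡ true → B y w₃ ≡ true → ⊥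
    ¬shared-targets {u} {x} {y} {w₁} {w₂} {w₃} u≢x u≢y x≢y w₁≢w₂ w₁≢w₃ w₂≢w₃ u₁ x₁ u₂ y₂ x₃ y₃
      with w₁ ≟ y | w₂ ≟ x | w₃ ≟ u
    ... | no w₁≢y | no w₂≢x | no w₃≢u = ¬patternA (embedding {S = S} (u ∷ x ∷ y ∷ w₁ ∷ w₃ ∷ w₂ ∷ [])
      ((u≢x ∷ u≢y ∷ B⇒≢ u₁ ∷ ≢-sym w₃≢u ∷ B⇒≢ u₂ ∷ []) ∷ (x≢y ∷ B⇒≢ x₁ ∷ B⇒≢ x₃ ∷ ≢-sym w₂≢x ∷ []) ∷
       (≢-sym w₁≢y ∷ B⇒≢ y₃ ∷ B⇒≢ y₂ ∷ []) ∷ (w₁≢w₃ ∷ w₁≢w₂ ∷ []) ∷ (≢-sym w₂≢w₃ ∷ []) ∷ [] ∷ [])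
      (source u₁ ∷ source x₁ ∷ source y₂ ∷ target u₁ ∷ target x₃ ∷ target u₂ ∷ [])
      (u₁ ∷ u₂ ∷ x₁ ∷ x₃ ∷ y₃ ∷ y₂ ∷ []))
    ... | no w₁≢y | no w₂≢x | yes refl = ¬patternC (embedding {S = S} (x ∷ u ∷ y ∷ w₁ ∷ w₂ ∷ [])
      ((≢-sym u≢x ∷ x≢y ∷ B⇒≢ x₁ ∷ ≢-sym w₂≢x ∷ []) ∷ (u≢y ∷ B⇒≢ u₁ ∷ B⇒≢ u₂ ∷ []) ∷
       (≢-sym w₁≢y ∷ B⇒≢ y₂ ∷ []) ∷ (w₁≢w₂ ∷ []) ∷ [] ∷ [])
      (source x₁ ∷ source u₁ ∷ source y₂ ∷ target u₁ ∷ target u₂ ∷ [])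
      (x₁ ∷ x₃ ∷ u₁ ∷ u₂ ∷ y₃ ∷ y₂ ∷ []))
    ... | yes refl | no w₂≢x | no w₃≢u = ¬patternC (embedding {S = S} (u ∷ y ∷ x ∷ w₂ ∷ w₃ ∷ [])
      ((u≢y ∷ u≢x ∷ B⇒≢ u₂ ∷ ≢-sym w₃≢u ∷ []) ∷ (≢-sym x≢y ∷ B⇒≢ y₂ ∷ B⇒≢ y₃ ∷ []) ∷
       (≢-sym w₂≢x ∷ B⇒≢ x₃ ∷ []) ∷ (w₂≢w₃ ∷ []) ∷ [] ∷ [])
      (source u₁ ∷ source y₂ ∷ source x₁ ∷ target u₂ ∷ target x₃ ∷ [])
      (u₂ ∷ u₁ ∷ y₂ ∷ y₃ ∷ x₁ ∷ x₃ ∷ []))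
    ... | no w₁≢y | yes refl | no w₃≢u = ¬patternC (embedding {S = S} (u ∷ x ∷ y ∷ w₁ ∷ w₃ ∷ [])
      ((u≢x ∷ u≢y ∷ B⇒≢ u₁ ∷ ≢-sym w₃≢u ∷ []) ∷ (x≢y ∷ B⇒≢ x₁ ∷ B⇒≢ x₃ ∷ []) ∷
       (≢-sym w₁≢y ∷ B⇒≢ y₃ ∷ []) ∷ (w₁≢w₃ ∷ []) ∷ [] ∷ [])
      (source u₁ ∷ source x₁ ∷ source y₂ ∷ target u₁ ∷ target x₃ ∷ [])
      (u₁ ∷ u₂ ∷ x₁ ∷ x₃ ∷ y₂ ∷ y₃ ∷ []))
    ... | yes refl | yes refl | no w₃≢u = ¬patternE (embedding {S = S} (x ∷ y ∷ w₃ ∷ u ∷ [])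
      ((x≢y ∷ B⇒≢ x₃ ∷ ≢-sym u≢x ∷ []) ∷ (B⇒≢ y₃ ∷ ≢-sym u≢y ∷ []) ∷ (w₃≢u ∷ []) ∷ [] ∷ [])
      (source x₁ ∷ source y₂ ∷ target x₃ ∷ source u₁ ∷ [])
      (x₁ ∷ y₂ ∷ x₃ ∷ y₃ ∷ u₂ ∷ u₁ ∷ []))
    ... | yes refl | no w₂≢x | yes refl = ¬patternE (embedding {S = S} (u ∷ y ∷ w₂ ∷ x ∷ [])
      ((u≢y ∷ B⇒≢ u₂ ∷ u≢x ∷ []) ∷ (B⇒≢ y₂ ∷ ≢-sym x≢y ∷ []) ∷ (w₂≢x ∷ []) ∷ [] ∷ [])
      (source u₁ ∷ source y₂ ∷ target u₂ ∷ source x₁ ∷ [])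
      (u₁ ∷ y₃ ∷ u₂ ∷ y₂ ∷ x₃ ∷ x₁ ∷ []))
    ... | no w₁≢y | yes refl | yes refl = ¬patternE (embedding {S = S} (u ∷ x ∷ w₁ ∷ y ∷ [])
      ((u≢x ∷ B⇒≢ u₁ ∷ u≢y ∷ []) ∷ (B⇒≢ x₁ ∷ x≢y ∷ []) ∷ (w₁≢y ∷ []) ∷ [] ∷ [])
      (source u₁ ∷ source x₁ ∷ target u₁ ∷ source y₂ ∷ [])
      (u₂ ∷ x₃ ∷ u₁ ∷ x₁ ∷ y₃ ∷ y₂ ∷ []))
    ... | yes refl | yes refl | yes refl = ¬patternD (embedding {S = S} (u ∷ x ∷ y ∷ [])
      ((u≢x ∷ u≢y ∷ []) ∷ (x≢y ∷ []) ∷ [] ∷ [])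
      (source u₁ ∷ source x₁ ∷ source y₂ ∷ [])
      (u₂ ∷ x₃ ∷ u₁ ∷ y₃ ∷ x₁ ∷ y₂ ∷ []))

    -- The two out-neighbours w₁, w₂ of u in S have second in-neighbours x, y; irredundancy
    -- separates x from y, and a common out-neighbour of x and y would create a triangle pattern.
    closed : WedgeClosed E C
    closed u Cu with C⇒arc Cu
    ... | w₁ , u₁ with another-out u₁
    ... | w₂ , w₂≢w₁ , u₂ with another-in u₁ | another-in u₂
    ... | x , x≢u , x₁ | y , y≢u , y₂ =
      x , y , x≢y , (≢-sym x≢u , w₁ , in-D u₁ , in-D x₁) , (≢-sym y≢u , w₂ , in-D u₂ , in-D y₂) ,
      ¬xy , source∈C x₁ , source∈C y₂
      where
        x≢y : x ≢ y
        x≢y refl = irr (embedding {S = S} (u ∷ x ∷ w₁ ∷ w₂ ∷ [])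
          ((≢-sym x≢u ∷ B⇒≢ u₁ ∷ B⇒≢ u₂ ∷ []) ∷ (B⇒≢ x₁ ∷ B⇒≢ y₂ ∷ []) ∷ (≢-sym w₂≢w₁ ∷ []) ∷ [] ∷ [])
          (source u₁ ∷ source x₁ ∷ target u₁ ∷ target u₂ ∷ [])
          (u₁ ∷ u₂ ∷ x₁ ∷ y₂ ∷ []))

        ¬xy : ¬ E x y
        ¬xy (_ , w₃ , x→w₃ , y→w₃) with another-out x₁ | another-out y₂
        ... | x′ , x′≢w₁ , x₃ | y′ , y′≢w₂ , y₃
          with out-neighbour (≢-sym x′≢w₁) (in-D x₁) (in-D x₃) x→w₃
             | out-neighbour (≢-sym y′≢w₂) (in-D y₂) (in-D y₃) y→w₃
        ... | inj₁ refl | _         = ¬three-in (≢-sym x≢u) (≢-sym y≢u) x≢y (in-D u₁) (in-D x₁) y→w₃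
        ... | inj₂ _    | inj₁ refl = ¬three-in (≢-sym y≢u) (≢-sym x≢u) (≢-sym x≢y) (in-D u₂) (in-D y₂) x→w₃
        ... | inj₂ refl | inj₂ refl =
          ¬shared-targets (≢-sym x≢u) (≢-sym y≢u) x≢y (≢-sym w₂≢w₁) (≢-sym x′≢w₁) (≢-sym y′≢w₂)
            u₁ x₁ u₂ y₂ x₃ y₃

    obstruction : HasArc S → Obstruction E
    obstruction (u , w , uw) = C , (u , source∈C uw) , closed

  forbidden⇒obstruction : ForbiddenSubdigraph D → Obstruction E
  forbidden⇒obstruction (S , bar , irr , ¬tri , arc) = SourcesOf.obstruction S bar irr ¬tri arc

corollary2p12 : ∀ {n : ℕ} (D : Digraph n) → Is⟨2,2⟩ D →
    (IsIntervalGraph (CompEdge D) ⇔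
      (¬ (Σ (Subdigraph D) λ S →
           IsBar⟨2,2⟩ S × Irredundant S × ¬ InducesTriangle S × HasArc S)))
corollary2p12 D h = mk⇔
  (λ interval forbidden → to interval (forbidden⇒obstruction forbidden))
  (λ ¬forbidden → from (¬forbidden ∘ obstruction⇒forbidden))
  where
    open ⟨2,2⟩Digraph D h
    open Equivalence (maxDegree2-interval⇔¬obstruction competition-maxDegree2)
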